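{- Let $G$ be a hypergraph and $k$ an integer. Let $(A,\overline A)$ be a separation of $G$ of order $<k$ that distinguishes two tangles, and let $(B,\overline B)$ be a mixed-$k$-well-linked separation of $G$. Then there are orientations $(A',\overline{A'})$ of $(A,\overline A)$ and $(B',\overline{B'})$ of $(B,\overline B)$ such that the separation $(A'\cup B',\ \overline{A'}\cap\overline{B'})$ distinguishes two tangles.
   Context: A hypergraph $G$ consists of finite sets $V(G)$, $E(G)$ and for each hyperedge $e$ a set $V(e)\subseteq V(G)$ (distinct hyperedges may share vertex sets), every vertex lying in some $V(e)$. For $X\subseteq E(G)$: $V(X)=\bigcup_{e\in X}V(e)$, $\overline X=E(G)\setminus X$, $\lambda(X)=|V(X)\cap V(\overline X)|$. A separation is a pair $(X,\overline X)$ of order $\lambda(X)$; an orientation of $(X,\overline X)$ is either $(X,\overline X)$ or $(\overline X,X)$. A bipartition of $X$ is a pair of disjoint, possibly empty, sets with union $X$. $X$ is well-linked if every bipartition $(B_1,B_2)$ of $X$ has $\lambda(B_1)\ge\lambda(X)$ or $\lambda(B_2)\ge\lambda(X)$; $X$ is $k$-well-linked if every bipartition has $\lambda(B_1)\ge\lambda(X)$, or $\lambda(B_2)\ge\lambda(X)$, or both $\lambda(B_1),\lambda(B_2)\ge k$. $(X,\overline X)$ is mixed-$k$-well-linked if one of $X,\overline X$ is well-linked and the other is $k$-well-linked. A tangle of order $k'$ is a family $\mathscr{T}$ of subsets of $E(G)$ with: (1) $\lambda(X)<k'$ for all $X\in\mathscr{T}$; (2) for every $X$ with $\lambda(X)<k'$,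 $X\in\mathscr{T}$ or $\overline X\in\mathscr{T}$; (3) no $X,Y,Z\in\mathscr{T}$ with $X\cup Y\cup Z=E(G)$; (4) $E(G)\setminus\{e\}\notin\mathscr{T}$ for all $e$. A separation $(X,\overline X)$ distinguishes tangles $\mathscr{T}_1,\mathscr{T}_2$ if $X\in\mathscr{T}_1$ and $\overline X\in\mathscr{T}_2$; "distinguishes two tangles" means this holds for some pair of tangles (of any orders). -}

module Defs where

open import Data.Nat using (ℕ; zero; suc; _<_; _≥_)
open import Data.Bool using (Bool; true; false; _∧_; _∨_)
open import Data.Fin using (Fin)
open import Data.Fin.Subset using (Subset; _∈_; _∪_; _∩_; ∁; ⊤; ⊥; ⁅_⁆; ∣_∣)
open import Data.Vec using (tabulate; lookup)
open import Data.Product using (Σ; ∃; ∃-syntax; _×_; _,_)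
open import Data.Sum using (_⊎_)
open import Relation.Binary.PropositionalEquality using (_≡_)
open import Relation.Nullary using (¬_)

-- A hypergraph: vertex set Fin n, hyperedge set Fin m, each hyperedge e has
-- a vertex set V(e) ⊆ Fin n (distinct hyperedges may share vertex sets),
-- and every vertex lies in some V(e).
record Hypergraph : Set where
  field
    n m    : ℕ
    edge   : Fin m → Subset n
    covers : (v : Fin n) → ∃[ e ] (v ∈ edge e)
open Hypergraph public

anyFin : ∀ {k} → (Fin k → Bool) → Bool
anyFin {zero}  f = false
anyFin {suc k} f = f Fin.zero ∨ anyFin (λ i → f (Fin.suc i))

ESet : Hypergraph → Set
ESet G = Subset (m G)

-- V(X) = union of V(e) over e ∈ X.
VOf : (G : Hypergraph) → ESet G → Subset (n G)
VOf G X = tabulate (λ v → anyFin (λ e → lookup X e ∧ lookup (edge G e) v))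

order : (G : Hypergraph) → ESet G → ℕ
order G X = ∣ VOf G X ∩ VOf G (∁ X) ∣

Bipartition : (G : Hypergraph) → ESet G → ESet G → ESet G → Set
Bipartition G X B₁ B₂ = (B₁ ∩ B₂ ≡ ⊥) × (B₁ ∪ B₂ ≡ X)

WellLinked : (G : Hypergraph) → ESet G → Set
WellLinked G X = ∀ B₁ B₂ → Bipartition G X B₁ B₂ →
  (order G B₁ ≥ order G X) ⊎ (order G B₂ ≥ order G X)

KWellLinked : (G : Hypergraph) → ℕ → ESet G → Set
KWellLinked G k X = ∀ B₁ B₂ → Bipartition G X B₁ B₂ →
  (order G B₁ ≥ order G X) ⊎ (order G B₂ ≥ order G X)
    ⊎ ((order G B₁ ≥ k) × (order G B₂ ≥ k))

MixedKWellLinked : (G : Hypergraph) → ℕ → ESet G → Set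
MixedKWellLinked G k X =
  (WellLinked G X × KWellLinked G k (∁ X)) ⊎ (WellLinked G (∁ X) × KWellLinked G k X)

Family : Hypergraph → Set
Family G = ESet G → Bool

InFam : (G : Hypergraph) → ESet G → Family G → Set
InFam G X 𝒯 = 𝒯 X ≡ true

record IsTangle (G : Hypergraph) (k' : ℕ) (𝒯 : Family G) : Set where
  field
    t1 : ∀ X → InFam G (X) 𝒯 → order G X < k'
    t2 : ∀ X → order G X < k' → InFam G (X) 𝒯 ⊎ InFam G (∁ X) 𝒯
    t3 : ∀ X Y Z → InFam G (X) 𝒯 → InFam G (Y) 𝒯 → InFam G (Z) 𝒯 → ¬ (X ∪ (Y ∪ Z) ≡ ⊤)
    t4 : ∀ e → ¬ InFam G (∁ ⁅ e ⁆) 𝒯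

DistinguishesTwoTangles : (G : Hypergraph) → ESet G → Set
DistinguishesTwoTangles G X =
  Σ ℕ λ k₁ → Σ ℕ λ k₂ → Σ (Family G) λ 𝒯₁ → Σ (Family G) λ 𝒯₂ →
    IsTangle G k₁ 𝒯₁ × IsTangle G k₂ 𝒯₂ × InFam G (X) 𝒯₁ × InFam G (∁ X) 𝒯₂

-- X' is (the first component of) an orientation of (X , complement X).
IsOrientation : (G : Hypergraph) → ESet G → ESet G → Set
IsOrientation G X X' = (X' ≡ X) ⊎ (X' ≡ ∁ X)

-- Let W be the well-linked one of B, B̄, and let 𝒯₁ ∋ A, 𝒯₂ ∋ Ā with a = λ(A).  By
-- submodularity of λ, well-linkedness of W at its bipartition by A gives, after possibly
-- swapping A with Ā and 𝒯₁ with 𝒯₂, λ(A ∪ W) ≤ a; so 𝒯₁ orients A ∪ W, and if it contains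
-- A ∪ W then (A, W) works.  Otherwise 𝒯₁ contains W̄ ∩ Ā, the complement of A ∪ W, whose
-- order is < k, so k-well-linkedness of W̄ at its bipartition by A leaves two cases:
-- λ(A ∪ W̄) ≤ a, and then (A, W̄) works; or λ(W) ≤ a.  In the last case W̄ ∈ 𝒯₁, and either
-- (Ā, W̄) works or W ∈ 𝒯₂.  Then A and W̄ both distinguish 𝒯₁ from 𝒯₂, and uncrossing them,
-- one of A ∪ W̄ and Ā ∪ W has order ≤ a and still distinguishes the two tangles.

module Submission where

open import Defs
open import Data.Nat using (ℕ; suc; _+_; _≤_; _<_; _≤?_)
open import Data.Nat.Properties
  using (+-suc; +-comm; +-mono-≤; +-monoˡ-≤; +-cancelˡ-≤; ≤-refl; ≤-reflexive; ≤-trans;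
         ≤-<-trans; <⇒≤; <⇒≱; ≰⇒>; module ≤-Reasoning)
open import Data.Bool using (Bool; true; false; _∧_; _∨_)
open import Data.Bool.Properties using (∨-zeroʳ; ∧-inverseʳ)
open import Data.Fin using (Fin)
open import Data.Vec using ([]; _∷_)
open import Data.Vec.Properties using (lookup∘tabulate; []=⇒lookup; lookup⇒[]=)
open import Data.Fin.Subset using (Subset; _∪_; _∩_; ∁; ⊤; ⊥; _∈_; _⊆_; ∣_∣)
open import Data.Fin.Subset.Properties
  using (∪-∩-booleanAlgebra; ∪-assoc; ∪-comm; ∩-comm; ∪-distribˡ-∩; ∩-distribˡ-∪;
         ∪-inverseʳ; ∩-identityˡ; ∩-identityʳ; p∪∁p≡⊤; _∈?_; x∉p⇒x∈∁p;
         x∈p∪q⁺; x∈p∪q⁻; x∈p∩q⁺; x∈p∩q⁻; p∩q⊆p; p∩q⊆q; p⊆p∪q; q⊆p∪q; p⊆q⇒∁p⊇∁q;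
         ⊆-refl; ⊆-reflexive; ⊆-trans; ⊆-antisym; ⊆⊤; p⊆q⇒∣p∣≤∣q∣)
import Algebra.Lattice.Properties.BooleanAlgebra as BooleanAlgebraProperties
open import Data.Product using (Σ; _×_; _,_; ∃-syntax)
open import Data.Sum as Sum using (_⊎_; inj₁; inj₂)
open import Data.Empty using (⊥-elim)
open import Function using (_∘_)
open import Relation.Binary.PropositionalEquality
open import Relation.Nullary using (¬_; yes; no)

module _ {n : ℕ} where
  open BooleanAlgebraProperties (∪-∩-booleanAlgebra n) public
    using () renaming (¬-involutive to ∁-involutive; deMorgan₁ to ∁-∩; deMorgan₂ to ∁-∪)

∣p∩q∣+∣p∪q∣≡∣p∣+∣q∣ : ∀ {n} (p q : Subset n) → ∣ p ∩ q ∣ + ∣ p ∪ q ∣ ≡ ∣ p ∣ + ∣ q ∣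
∣p∩q∣+∣p∪q∣≡∣p∣+∣q∣ []          []          = refl
∣p∩q∣+∣p∪q∣≡∣p∣+∣q∣ (true ∷ p)  (true ∷ q)  =
  cong suc (trans (+-suc _ _) (trans (cong suc (∣p∩q∣+∣p∪q∣≡∣p∣+∣q∣ p q)) (sym (+-suc _ _))))
∣p∩q∣+∣p∪q∣≡∣p∣+∣q∣ (true ∷ p)  (false ∷ q) =
  trans (+-suc _ _) (cong suc (∣p∩q∣+∣p∪q∣≡∣p∣+∣q∣ p q))
∣p∩q∣+∣p∪q∣≡∣p∣+∣q∣ (false ∷ p) (true ∷ q)  =
  trans (+-suc _ _) (trans (cong suc (∣p∩q∣+∣p∪q∣≡∣p∣+∣q∣ p q)) (sym (+-suc _ _)))
∣p∩q∣+∣p∪q∣≡∣p∣+∣q∣ (false ∷ p) (false ∷ q) = ∣p∩q∣+∣p∪q∣≡∣p∣+∣q∣ p q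

p∩q∩[p∩∁q]≡⊥ : ∀ {n} (p q : Subset n) → (p ∩ q) ∩ (p ∩ ∁ q) ≡ ⊥
p∩q∩[p∩∁q]≡⊥ []          []      = refl
p∩q∩[p∩∁q]≡⊥ (false ∷ p) (_ ∷ q) = cong (false ∷_) (p∩q∩[p∩∁q]≡⊥ p q)
p∩q∩[p∩∁q]≡⊥ (true ∷ p)  (y ∷ q) = cong₂ _∷_ (∧-inverseʳ y) (p∩q∩[p∩∁q]≡⊥ p q)

p∩q∪[p∩∁q]≡p : ∀ {n} (p q : Subset n) → (p ∩ q) ∪ (p ∩ ∁ q) ≡ p
p∩q∪[p∩∁q]≡p p q = begin
  (p ∩ q) ∪ (p ∩ ∁ q) ≡⟨ ∩-distribˡ-∪ p q (∁ q) ⟨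
  p ∩ (q ∪ ∁ q)       ≡⟨ cong (p ∩_) (p∪∁p≡⊤ q) ⟩
  p ∩ ⊤               ≡⟨ ∩-identityʳ p ⟩
  p                   ∎
  where open ≡-Reasoning

p∪∁[p∪q]≡p∪∁q : ∀ {n} (p q : Subset n) → p ∪ ∁ (p ∪ q) ≡ p ∪ ∁ q
p∪∁[p∪q]≡p∪∁q p q = begin
  p ∪ ∁ (p ∪ q)             ≡⟨ cong (p ∪_) (∁-∪ p q) ⟩
  p ∪ (∁ p ∩ ∁ q)           ≡⟨ ∪-distribˡ-∩ p (∁ p) (∁ q) ⟩
  (p ∪ ∁ p) ∩ (p ∪ ∁ q)     ≡⟨ cong (_∩ (p ∪ ∁ q)) (∪-inverseʳ p) ⟩
  ⊤ ∩ (p ∪ ∁ q)             ≡⟨ ∩-identityˡ (p ∪ ∁ q) ⟩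
  p ∪ ∁ q                   ∎
  where open ≡-Reasoning

∁q⊆p∪∁[p∪q] : ∀ {n} (p q : Subset n) → ∁ q ⊆ p ∪ ∁ (p ∪ q)
∁q⊆p∪∁[p∪q] p q = ⊆-trans (q⊆p∪q p (∁ q)) (⊆-reflexive (sym (p∪∁[p∪q]≡p∪∁q p q)))

⊆⇒∪∁≡⊤ : ∀ {n} {p q : Subset n} → p ⊆ q → q ∪ ∁ p ≡ ⊤
⊆⇒∪∁≡⊤ {p = p} {q} p⊆q = ⊆-antisym ⊆⊤ covered
  where
  covered : ⊤ ⊆ q ∪ ∁ p
  covered {x} _ with x ∈? p
  ... | yes x∈p = x∈p∪q⁺ (inj₁ (p⊆q x∈p))
  ... | no  x∉p = x∈p∪q⁺ (inj₂ (x∉p⇒x∈∁p x∉p))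

m+n≤o+p∧p≤m⇒n≤o : ∀ {m n o p} → m + n ≤ o + p → p ≤ m → n ≤ o
m+n≤o+p∧p≤m⇒n≤o {m} {n} {o} {p} m+n≤o+p p≤m = +-cancelˡ-≤ p n o (begin
  p + n ≤⟨ +-monoˡ-≤ n p≤m ⟩
  m + n ≤⟨ m+n≤o+p ⟩
  o + p ≡⟨ +-comm o p ⟩
  p + o ∎)
  where open ≤-Reasoning

m+n≤o+o⇒m≤o⊎n≤o : ∀ {m n o} → m + n ≤ o + o → m ≤ o ⊎ n ≤ o
m+n≤o+o⇒m≤o⊎n≤o {m} {n} {o} m+n≤o+o with m ≤? o
... | yes m≤o = inj₁ m≤o
... | no  m≰o = inj₂ (m+n≤o+p∧p≤m⇒n≤o m+n≤o+o (<⇒≤ (≰⇒> m≰o)))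

anyFin-witness : ∀ {k} (f : Fin k → Bool) → anyFin f ≡ true → ∃[ i ] f i ≡ true
anyFin-witness {suc k} f any with f Fin.zero in eq
... | true  = Fin.zero , eq
... | false with i , fi ← anyFin-witness (f ∘ Fin.suc) any = Fin.suc i , fi

anyFin-intro : ∀ {k} (f : Fin k → Bool) i → f i ≡ true → anyFin f ≡ true
anyFin-intro f Fin.zero    fi = cong (_∨ anyFin (f ∘ Fin.suc)) fi
anyFin-intro f (Fin.suc i) fi =
  trans (cong (f Fin.zero ∨_) (anyFin-intro (f ∘ Fin.suc) i fi)) (∨-zeroʳ (f Fin.zero))

∧≡true⁻ : ∀ {x y} → x ∧ y ≡ true → x ≡ true × y ≡ true
∧≡true⁻ {true}  y≡true = refl , y≡true
∧≡true⁻ {false} ()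

module _ (G : Hypergraph) where

  ∈VOf⁻ : ∀ {X v} → v ∈ VOf G X → ∃[ e ] (e ∈ X × v ∈ edge G e)
  ∈VOf⁻ {X} {v} v∈VX
    with e , X∧e≡true ← anyFin-witness _ (trans (sym (lookup∘tabulate _ v)) ([]=⇒lookup v∈VX))
    with X≡true , e≡true ← ∧≡true⁻ X∧e≡true
    = e , lookup⇒[]= e X X≡true , lookup⇒[]= v (edge G e) e≡true

  ∈VOf⁺ : ∀ {X v e} → e ∈ X → v ∈ edge G e → v ∈ VOf G X
  ∈VOf⁺ {X} {v} {e} e∈X v∈e = lookup⇒[]= v (VOf G X) (trans (lookup∘tabulate _ v)
    (anyFin-intro _ e (cong₂ _∧_ ([]=⇒lookup e∈X) ([]=⇒lookup v∈e))))

  VOf-mono : ∀ {X Y} → X ⊆ Y → VOf G X ⊆ VOf G Y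
  VOf-mono X⊆Y v∈VX with e , e∈X , v∈e ← ∈VOf⁻ v∈VX = ∈VOf⁺ (X⊆Y e∈X) v∈e

  VOf-∪ : ∀ X Y → VOf G (X ∪ Y) ⊆ VOf G X ∪ VOf G Y
  VOf-∪ X Y v∈V[X∪Y] with e , e∈X∪Y , v∈e ← ∈VOf⁻ v∈V[X∪Y] =
    x∈p∪q⁺ (Sum.map (λ e∈X → ∈VOf⁺ e∈X v∈e) (λ e∈Y → ∈VOf⁺ e∈Y v∈e) (x∈p∪q⁻ X Y e∈X∪Y))

  ∂ : ESet G → Subset (n G)
  ∂ X = VOf G X ∩ VOf G (∁ X)

  module _ (X Y : ESet G) where

    private
      V∩⊆Vˡ : VOf G (X ∩ Y) ⊆ VOf G X
      V∩⊆Vˡ = VOf-mono {X ∩ Y} (p∩q⊆p X Y)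

      V∩⊆Vʳ : VOf G (X ∩ Y) ⊆ VOf G Y
      V∩⊆Vʳ = VOf-mono {X ∩ Y} (p∩q⊆q X Y)

      V∁∪⊆V∁ˡ : VOf G (∁ (X ∪ Y)) ⊆ VOf G (∁ X)
      V∁∪⊆V∁ˡ = VOf-mono {∁ (X ∪ Y)} (p⊆q⇒∁p⊇∁q (p⊆p∪q Y))

      V∁∪⊆V∁ʳ : VOf G (∁ (X ∪ Y)) ⊆ VOf G (∁ Y)
      V∁∪⊆V∁ʳ = VOf-mono {∁ (X ∪ Y)} (p⊆q⇒∁p⊇∁q (q⊆p∪q X Y))

      V∁∩⊆V∁∪V∁ : VOf G (∁ (X ∩ Y)) ⊆ VOf G (∁ X) ∪ VOf G (∁ Y)
      V∁∩⊆V∁∪V∁ = VOf-∪ (∁ X) (∁ Y) ∘ VOf-mono {∁ (X ∩ Y)} (⊆-reflexive (∁-∩ X Y))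

    ∂∩∩∂∪⊆∂∩∂ : ∂ (X ∩ Y) ∩ ∂ (X ∪ Y) ⊆ ∂ X ∩ ∂ Y
    ∂∩∩∂∪⊆∂∩∂ v∈
      with v∈∂[X∩Y] , v∈∂[X∪Y] ← x∈p∩q⁻ _ _ v∈
      with v∈V[X∩Y] , _ ← x∈p∩q⁻ _ _ v∈∂[X∩Y]
      with _ , v∈V∁[X∪Y] ← x∈p∩q⁻ _ _ v∈∂[X∪Y]
      = x∈p∩q⁺ ( x∈p∩q⁺ (V∩⊆Vˡ v∈V[X∩Y] , V∁∪⊆V∁ˡ v∈V∁[X∪Y])
               , x∈p∩q⁺ (V∩⊆Vʳ v∈V[X∩Y] , V∁∪⊆V∁ʳ v∈V∁[X∪Y]))

    ∂∩∪∂∪⊆∂∪∂ : ∂ (X ∩ Y) ∪ ∂ (X ∪ Y) ⊆ ∂ X ∪ ∂ Y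
    ∂∩∪∂∪⊆∂∪∂ v∈ with x∈p∪q⁻ (∂ (X ∩ Y)) (∂ (X ∪ Y)) v∈
    ... | inj₁ v∈∂[X∩Y] with v∈V[X∩Y] , v∈V∁[X∩Y] ← x∈p∩q⁻ _ _ v∈∂[X∩Y] =
      x∈p∪q⁺ (Sum.map (λ v∈V∁X → x∈p∩q⁺ (V∩⊆Vˡ v∈V[X∩Y] , v∈V∁X))
                      (λ v∈V∁Y → x∈p∩q⁺ (V∩⊆Vʳ v∈V[X∩Y] , v∈V∁Y))
                      (x∈p∪q⁻ (VOf G (∁ X)) (VOf G (∁ Y)) (V∁∩⊆V∁∪V∁ v∈V∁[X∩Y])))
    ... | inj₂ v∈∂[X∪Y] with v∈V[X∪Y] , v∈V∁[X∪Y] ← x∈p∩q⁻ _ _ v∈∂[X∪Y] =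
      x∈p∪q⁺ (Sum.map (λ v∈VX → x∈p∩q⁺ (v∈VX , V∁∪⊆V∁ˡ v∈V∁[X∪Y]))
                      (λ v∈VY → x∈p∩q⁺ (v∈VY , V∁∪⊆V∁ʳ v∈V∁[X∪Y]))
                      (x∈p∪q⁻ (VOf G X) (VOf G Y) (VOf-∪ X Y v∈V[X∪Y])))

  order-submodular : ∀ X Y → order G (X ∩ Y) + order G (X ∪ Y) ≤ order G X + order G Y
  order-submodular X Y = begin
    ∣ ∂ (X ∩ Y) ∣ + ∣ ∂ (X ∪ Y) ∣
      ≡⟨ ∣p∩q∣+∣p∪q∣≡∣p∣+∣q∣ (∂ (X ∩ Y)) (∂ (X ∪ Y)) ⟨
    ∣ ∂ (X ∩ Y) ∩ ∂ (X ∪ Y) ∣ + ∣ ∂ (X ∩ Y) ∪ ∂ (X ∪ Y) ∣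
      ≤⟨ +-mono-≤ (p⊆q⇒∣p∣≤∣q∣ (∂∩∩∂∪⊆∂∩∂ X Y)) (p⊆q⇒∣p∣≤∣q∣ (∂∩∪∂∪⊆∂∪∂ X Y)) ⟩
    ∣ ∂ X ∩ ∂ Y ∣ + ∣ ∂ X ∪ ∂ Y ∣
      ≡⟨ ∣p∩q∣+∣p∪q∣≡∣p∣+∣q∣ (∂ X) (∂ Y) ⟩
    ∣ ∂ X ∣ + ∣ ∂ Y ∣ ∎
    where open ≤-Reasoning

  order-∁ : ∀ X → order G (∁ X) ≡ order G X
  order-∁ X = trans (cong (λ Y → ∣ VOf G (∁ X) ∩ VOf G Y ∣) (∁-involutive X))
                    (cong ∣_∣ (∩-comm (VOf G (∁ X)) (VOf G X)))

  order-∪-≤ : ∀ X Y → order G Y ≤ order G (Y ∩ X) → order G (X ∪ Y) ≤ order G X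
  order-∪-≤ X Y λY≤λ[Y∩X] = m+n≤o+p∧p≤m⇒n≤o (order-submodular X Y)
    (subst (λ Z → order G Y ≤ order G Z) (∩-comm Y X) λY≤λ[Y∩X])

  order-∁∩∁ : ∀ X Y → order G (∁ X ∩ ∁ Y) ≡ order G (Y ∪ X)
  order-∁∩∁ X Y = begin
    order G (∁ X ∩ ∁ Y)  ≡⟨ cong (order G) (∁-∪ X Y) ⟨
    order G (∁ (X ∪ Y))  ≡⟨ order-∁ (X ∪ Y) ⟩
    order G (X ∪ Y)      ≡⟨ cong (order G) (∪-comm X Y) ⟩
    order G (Y ∪ X)      ∎
    where open ≡-Reasoning

  bipartition-∩-∁ : ∀ X Y → Bipartition G X (X ∩ Y) (X ∩ ∁ Y)
  bipartition-∩-∁ X Y = p∩q∩[p∩∁q]≡⊥ X Y , p∩q∪[p∩∁q]≡p X Y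

  infix 4 _∈ₜ_
  _∈ₜ_ : ESet G → Family G → Set
  X ∈ₜ 𝒯 = InFam G X 𝒯

  ∁∁-∈ₜ : ∀ 𝒯 X → X ∈ₜ 𝒯 → ∁ (∁ X) ∈ₜ 𝒯
  ∁∁-∈ₜ 𝒯 X = subst (_∈ₜ 𝒯) (sym (∁-involutive X))

  module _ {k' : ℕ} {𝒯 : Family G} (𝒯-tangle : IsTangle G k' 𝒯) where
    open IsTangle 𝒯-tangle

    ∁-∉ₜ : ∀ X Y Z → X ∈ₜ 𝒯 → Y ∈ₜ 𝒯 → Z ⊆ X ∪ Y → ¬ ∁ Z ∈ₜ 𝒯
    ∁-∉ₜ X Y Z X∈𝒯 Y∈𝒯 Z⊆X∪Y ∁Z∈𝒯 =
      t3 X Y (∁ Z) X∈𝒯 Y∈𝒯 ∁Z∈𝒯 (trans (sym (∪-assoc X Y (∁ Z))) (⊆⇒∪∁≡⊤ Z⊆X∪Y))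

    ⊆∪-closed : ∀ X Y Z → X ∈ₜ 𝒯 → Y ∈ₜ 𝒯 → Z ⊆ X ∪ Y → order G Z < k' → Z ∈ₜ 𝒯
    ⊆∪-closed X Y Z X∈𝒯 Y∈𝒯 Z⊆X∪Y λZ<k' with t2 Z λZ<k'
    ... | inj₁ Z∈𝒯  = Z∈𝒯
    ... | inj₂ ∁Z∈𝒯 = ⊥-elim (∁-∉ₜ X Y Z X∈𝒯 Y∈𝒯 Z⊆X∪Y ∁Z∈𝒯)

    ⊆-closed : ∀ X Z → X ∈ₜ 𝒯 → Z ⊆ X → order G Z < k' → Z ∈ₜ 𝒯
    ⊆-closed X Z X∈𝒯 Z⊆X = ⊆∪-closed X X Z X∈𝒯 X∈𝒯 (⊆-trans Z⊆X (p⊆p∪q X))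

    ∪-closed : ∀ X Y → X ∈ₜ 𝒯 → Y ∈ₜ 𝒯 → order G (X ∪ Y) < k' → X ∪ Y ∈ₜ 𝒯
    ∪-closed X Y X∈𝒯 Y∈𝒯 = ⊆∪-closed X Y (X ∪ Y) X∈𝒯 Y∈𝒯 ⊆-refl

    order-below : ∀ X Y → X ∈ₜ 𝒯 → order G Y ≤ order G X → order G Y < k'
    order-below X Y X∈𝒯 λY≤λX = ≤-<-trans λY≤λX (t1 X X∈𝒯)

    order-below-∁ : ∀ X Y → ∁ X ∈ₜ 𝒯 → order G Y ≤ order G X → order G Y < k'
    order-below-∁ X Y ∁X∈𝒯 λY≤λX =
      order-below (∁ X) Y ∁X∈𝒯 (subst (order G Y ≤_) (sym (order-∁ X)) λY≤λX)

  Distinguishes : ESet G → Set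
  Distinguishes = DistinguishesTwoTangles G

  distinguishes-∁ : ∀ X → Distinguishes X → Distinguishes (∁ X)
  distinguishes-∁ X (k₁ , k₂ , 𝒯₁ , 𝒯₂ , t₁ , t₂ , X∈𝒯₁ , ∁X∈𝒯₂) =
    k₂ , k₁ , 𝒯₂ , 𝒯₁ , t₂ , t₁ , ∁X∈𝒯₂ , ∁∁-∈ₜ 𝒯₁ X X∈𝒯₁

  distinguishes-⊇ : ∀ {k₁ k₂ 𝒯₁ 𝒯₂} → IsTangle G k₁ 𝒯₁ → IsTangle G k₂ 𝒯₂ →
    ∀ P Q → P ⊆ Q → Q ∈ₜ 𝒯₁ → ∁ P ∈ₜ 𝒯₂ → order G Q ≤ order G P → Distinguishes Q
  distinguishes-⊇ {k₁} {k₂} {𝒯₁} {𝒯₂} t₁ t₂ P Q P⊆Q Q∈𝒯₁ ∁P∈𝒯₂ λQ≤λP =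
    k₁ , k₂ , 𝒯₁ , 𝒯₂ , t₁ , t₂ , Q∈𝒯₁ ,
    ⊆-closed t₂ (∁ P) (∁ Q) ∁P∈𝒯₂ (p⊆q⇒∁p⊇∁q P⊆Q) (order-below-∁ t₂ P (∁ Q) ∁P∈𝒯₂ λ∁Q≤λP)
    where
    λ∁Q≤λP : order G (∁ Q) ≤ order G P
    λ∁Q≤λP = subst (_≤ order G P) (sym (order-∁ Q)) λQ≤λP

  uncross : ∀ {k₁ k₂ 𝒯₁ 𝒯₂} → IsTangle G k₁ 𝒯₁ → IsTangle G k₂ 𝒯₂ →
    ∀ X Y → X ∈ₜ 𝒯₁ → Y ∈ₜ 𝒯₁ → ∁ X ∈ₜ 𝒯₂ → ∁ Y ∈ₜ 𝒯₂ → order G Y ≤ order G X →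
    Distinguishes (X ∪ Y) ⊎ Distinguishes (∁ X ∪ ∁ Y)
  uncross {𝒯₁ = 𝒯₁} t₁ t₂ X Y X∈𝒯₁ Y∈𝒯₁ ∁X∈𝒯₂ ∁Y∈𝒯₂ λY≤λX
    with m+n≤o+o⇒m≤o⊎n≤o (≤-trans (order-submodular X Y) (+-mono-≤ ≤-refl λY≤λX))
  ... | inj₂ λ[X∪Y]≤λX = inj₁ (distinguishes-⊇ t₁ t₂ X (X ∪ Y) (p⊆p∪q Y)
    (∪-closed t₁ X Y X∈𝒯₁ Y∈𝒯₁ (order-below t₁ X (X ∪ Y) X∈𝒯₁ λ[X∪Y]≤λX)) ∁X∈𝒯₂ λ[X∪Y]≤λX)
  ... | inj₁ λ[X∩Y]≤λX = inj₂ (distinguishes-⊇ t₂ t₁ (∁ X) (∁ X ∪ ∁ Y) (p⊆p∪q (∁ Y))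
    (∪-closed t₂ (∁ X) (∁ Y) ∁X∈𝒯₂ ∁Y∈𝒯₂ (order-below-∁ t₂ X (∁ X ∪ ∁ Y) ∁X∈𝒯₂ λ[∁X∪∁Y]≤λX))
    (∁∁-∈ₜ 𝒯₁ X X∈𝒯₁) (subst (order G (∁ X ∪ ∁ Y) ≤_) (sym (order-∁ X)) λ[∁X∪∁Y]≤λX))
    where
    λ[∁X∪∁Y]≤λX : order G (∁ X ∪ ∁ Y) ≤ order G X
    λ[∁X∪∁Y]≤λX = subst (_≤ order G X)
      (trans (sym (order-∁ (X ∩ Y))) (cong (order G) (∁-∩ X Y))) λ[X∩Y]≤λX

  OrientedUnionDistinguishes : ESet G → ESet G → Set
  OrientedUnionDistinguishes A B = Σ (ESet G) λ A' → Σ (ESet G) λ B' →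
    IsOrientation G A A' × IsOrientation G B B' × Distinguishes (A' ∪ B')

  orientation-trans : ∀ {X Y Z} → IsOrientation G X Y → IsOrientation G Y Z → IsOrientation G X Z
  orientation-trans     X↝Y          (inj₁ refl) = X↝Y
  orientation-trans     (inj₁ refl) (inj₂ refl) = inj₂ refl
  orientation-trans {X} (inj₂ refl) (inj₂ refl) = inj₁ (∁-involutive X)

  reorient : ∀ {A A₀ B B₀} → IsOrientation G A A₀ → IsOrientation G B B₀ →
    OrientedUnionDistinguishes A₀ B₀ → OrientedUnionDistinguishes A B
  reorient A↝A₀ B↝B₀ (A' , B' , A₀↝A' , B₀↝B' , A'∪B'-dist) =
    A' , B' , orientation-trans A↝A₀ A₀↝A' , orientation-trans B↝B₀ B₀↝B' , A'∪B'-dist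

  module _ {k₁ k₂ 𝒯₁ 𝒯₂} (t₁ : IsTangle G k₁ 𝒯₁) (t₂ : IsTangle G k₂ 𝒯₂)
           (P W : ESet G) (P∈𝒯₁ : P ∈ₜ 𝒯₁) (∁P∈𝒯₂ : ∁ P ∈ₜ 𝒯₂)
           (λ[P∪W]≤λP : order G (P ∪ W) ≤ order G P) where

    private
      λ[∁W∩∁P]≤λP : order G (∁ W ∩ ∁ P) ≤ order G P
      λ[∁W∩∁P]≤λP = ≤-trans (≤-reflexive (order-∁∩∁ W P)) λ[P∪W]≤λP

      P∪∁W-distinguishes : ∁ (P ∪ W) ∈ₜ 𝒯₁ → order G (P ∪ ∁ W) ≤ order G P →
        Distinguishes (P ∪ ∁ W)
      P∪∁W-distinguishes ∁[P∪W]∈𝒯₁ λ[P∪∁W]≤λP =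
        distinguishes-⊇ t₁ t₂ P (P ∪ ∁ W) (p⊆p∪q (∁ W)) P∪∁W∈𝒯₁ ∁P∈𝒯₂ λ[P∪∁W]≤λP
        where
        P∪∁W∈𝒯₁ : P ∪ ∁ W ∈ₜ 𝒯₁
        P∪∁W∈𝒯₁ = ⊆∪-closed t₁ P (∁ (P ∪ W)) (P ∪ ∁ W) P∈𝒯₁ ∁[P∪W]∈𝒯₁
          (⊆-reflexive (sym (p∪∁[p∪q]≡p∪∁q P W))) (order-below t₁ P (P ∪ ∁ W) P∈𝒯₁ λ[P∪∁W]≤λP)

    module _ (∁[P∪W]∈𝒯₁ : ∁ (P ∪ W) ∈ₜ 𝒯₁) (λ∁W≤λP : order G (∁ W) ≤ order G P) where

      private
        ∁W∈𝒯₁ : ∁ W ∈ₜ 𝒯₁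
        ∁W∈𝒯₁ = ⊆∪-closed t₁ P (∁ (P ∪ W)) (∁ W) P∈𝒯₁ ∁[P∪W]∈𝒯₁ (∁q⊆p∪∁[p∪q] P W)
          (order-below t₁ P (∁ W) P∈𝒯₁ λ∁W≤λP)

        ∁∁W∈𝒯₂ : ∁ (∁ P ∪ ∁ W) ∈ₜ 𝒯₂ → ∁ (∁ W) ∈ₜ 𝒯₂
        ∁∁W∈𝒯₂ ∁[∁P∪∁W]∈𝒯₂ = ⊆∪-closed t₂ (∁ P) (∁ (∁ P ∪ ∁ W)) (∁ (∁ W)) ∁P∈𝒯₂ ∁[∁P∪∁W]∈𝒯₂
          (∁q⊆p∪∁[p∪q] (∁ P) (∁ W))
          (order-below-∁ t₂ P (∁ (∁ W)) ∁P∈𝒯₂ (subst (_≤ order G P) (sym (order-∁ (∁ W))) λ∁W≤λP))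

      both-orient-W : order G (∁ P ∪ ∁ W) ≤ order G (∁ P) → OrientedUnionDistinguishes P W
      both-orient-W λ[∁P∪∁W]≤λ∁P
        with IsTangle.t2 t₂ (∁ P ∪ ∁ W) (order-below t₂ (∁ P) (∁ P ∪ ∁ W) ∁P∈𝒯₂ λ[∁P∪∁W]≤λ∁P)
      ... | inj₁ ∁P∪∁W∈𝒯₂ = ∁ P , ∁ W , inj₂ refl , inj₂ refl ,
        distinguishes-⊇ t₂ t₁ (∁ P) (∁ P ∪ ∁ W) (p⊆p∪q (∁ W)) ∁P∪∁W∈𝒯₂ (∁∁-∈ₜ 𝒯₁ P P∈𝒯₁)
          λ[∁P∪∁W]≤λ∁P
      ... | inj₂ ∁[∁P∪∁W]∈𝒯₂
        with uncross t₁ t₂ P (∁ W) P∈𝒯₁ ∁W∈𝒯₁ ∁P∈𝒯₂ (∁∁W∈𝒯₂ ∁[∁P∪∁W]∈𝒯₂) λ∁W≤λP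
      ... | inj₁ P∪∁W-dist    = P , ∁ W , inj₁ refl , inj₂ refl , P∪∁W-dist
      ... | inj₂ ∁P∪∁∁W-dist = ∁ P , ∁ (∁ W) , inj₂ refl , inj₁ (∁-involutive W) , ∁P∪∁∁W-dist

    oriented-union-distinguishes : ∀ {k} → order G P < k → KWellLinked G k (∁ W) →
      OrientedUnionDistinguishes P W
    oriented-union-distinguishes λP<k ∁W-kwl
      with IsTangle.t2 t₁ (P ∪ W) (order-below t₁ P (P ∪ W) P∈𝒯₁ λ[P∪W]≤λP)
    ... | inj₁ P∪W∈𝒯₁ = P , W , inj₁ refl , inj₁ refl ,
      distinguishes-⊇ t₁ t₂ P (P ∪ W) (p⊆p∪q W) P∪W∈𝒯₁ ∁P∈𝒯₂ λ[P∪W]≤λP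
    ... | inj₂ ∁[P∪W]∈𝒯₁ with ∁W-kwl (∁ W ∩ P) (∁ W ∩ ∁ P) (bipartition-∩-∁ (∁ W) P)
    ... | inj₁ λ∁W≤λ[∁W∩P] = P , ∁ W , inj₁ refl , inj₂ refl ,
      P∪∁W-distinguishes ∁[P∪W]∈𝒯₁ (order-∪-≤ P (∁ W) λ∁W≤λ[∁W∩P])
    ... | inj₂ (inj₁ λ∁W≤λ[∁W∩∁P]) =
      both-orient-W ∁[P∪W]∈𝒯₁ (≤-trans λ∁W≤λ[∁W∩∁P] λ[∁W∩∁P]≤λP)
        (order-∪-≤ (∁ P) (∁ W) λ∁W≤λ[∁W∩∁P])
    ... | inj₂ (inj₂ (_ , k≤λ[∁W∩∁P])) =
      ⊥-elim (<⇒≱ (≤-<-trans λ[∁W∩∁P]≤λP λP<k) k≤λ[∁W∩∁P])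

  well-linked-orientation : ∀ {k} B → MixedKWellLinked G k B →
    Σ (ESet G) λ W → IsOrientation G B W × WellLinked G W × KWellLinked G k (∁ W)
  well-linked-orientation B (inj₁ (B-wl , ∁B-kwl)) = B , inj₁ refl , B-wl , ∁B-kwl
  well-linked-orientation {k} B (inj₂ (∁B-wl , B-kwl)) =
    ∁ B , inj₂ refl , ∁B-wl , subst (KWellLinked G k) (sym (∁-involutive B)) B-kwl

  ∪-order-≤-orientation : ∀ W A → WellLinked G W → Distinguishes A →
    Σ (ESet G) λ P → IsOrientation G A P × Distinguishes P ×
      order G P ≡ order G A × order G (P ∪ W) ≤ order G P
  ∪-order-≤-orientation W A W-wl A-dist with W-wl (W ∩ A) (W ∩ ∁ A) (bipartition-∩-∁ W A)
  ... | inj₁ λW≤λ[W∩A]  = A , inj₁ refl , A-dist , refl , order-∪-≤ A W λW≤λ[W∩A]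
  ... | inj₂ λW≤λ[W∩∁A] = ∁ A , inj₂ refl , distinguishes-∁ A A-dist , order-∁ A ,
    order-∪-≤ (∁ A) W λW≤λ[W∩∁A]

lemma6p15 : (G : Hypergraph) (k : ℕ) (A B : ESet G) →
    order G A < k → DistinguishesTwoTangles G A → MixedKWellLinked G k B →
    Σ (ESet G) λ A' → Σ (ESet G) λ B' →
      IsOrientation G A A' × IsOrientation G B B' × DistinguishesTwoTangles G (A' ∪ B')
lemma6p15 G k A B λA<k A-dist B-mixed =
  let W , B↝W , W-wl , ∁W-kwl = well-linked-orientation G B B-mixed
      P , A↝P , P-dist , λP≡λA , λ[P∪W]≤λP = ∪-order-≤-orientation G W A W-wl A-dist
      _ , _ , _ , _ , t₁ , t₂ , P∈𝒯₁ , ∁P∈𝒯₂ = P-dist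
  in reorient G A↝P B↝W (oriented-union-distinguishes G t₁ t₂ P W P∈𝒯₁ ∁P∈𝒯₂ λ[P∪W]≤λP
       (subst (_< k) (sym λP≡λA) λA<k) ∁W-kwl)
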